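{- For all integers $n\ge 0$, \[ a^{ -\{1,2\}}_{5,1}(n)\le a^{ -\{1,2\}}_{5,3}(n). \]
   Context: A partition of $n$ is a non-increasing sequence of positive integers summing to $n$; its Young diagram is the left-justified array of boxes whose $i$-th row has $\lambda_i$ boxes. The hook length of a box is the number of boxes directly to its right, plus the number directly below it, plus $1$; a box of hook length $k$ is a $k$-hook. For $t\ge 2$, a $t$-core partition is a partition none of whose hook lengths is divisible by $t$. For a set $C$ of positive integers, $a^{ -C}_{t,k}(n)$ denotes the total number of hooks of length $k$ summed over all $t$-core partitions of $n$ none of whose parts belongs to $C$. -}

module Defs where

open import Data.Nat using (ℕ; zero; suc; _+_; _∸_; _≤_; _<_; _≥_; _<?_; _≟_)
open import Data.Nat.Divisibility using (_∣_)
open import Data.List using (List; []; _∷_; length; filter; upTo; map; _++_)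
open import Data.Nat.ListAction using (sum)
open import Data.List.Relation.Unary.All using (All)
open import Data.List.Relation.Unary.Linked using (Linked)
open import Data.List.Membership.Propositional using (_∉_)
open import Data.Product using (_×_)
open import Relation.Nullary using (¬_)
open import Relation.Binary.PropositionalEquality using (_≡_)

IsPartition : ℕ → List ℕ → Set
IsPartition n λs = Linked _≥_ λs × All (0 <_) λs × sum λs ≡ n

-- number of parts strictly greater than j  (= length of column j, 0-indexed)
colLen : List ℕ → ℕ → ℕ
colLen λs j = length (filter (j <?_) λs)

-- hook lengths of all boxes of the Young diagram, row by row.
-- box (i , j) (0-indexed, j < λᵢ): arm = λᵢ - j - 1, leg = λ'ⱼ - i - 1,
-- hook = arm + leg + 1.
hooksFrom : List ℕ → ℕ → List ℕ → List ℕ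
hooksFrom λs i []       = []
hooksFrom λs i (r ∷ rs) =
  map (λ j → ((r ∸ j) ∸ 1) + ((colLen λs j ∸ i) ∸ 1) + 1) (upTo r)
  ++ hooksFrom λs (suc i) rs

hooks : List ℕ → List ℕ
hooks λs = hooksFrom λs 0 λs

numHooks : ℕ → List ℕ → ℕ
numHooks k λs = length (filter (_≟ k) (hooks λs))

IsCore : ℕ → List ℕ → Set
IsCore t λs = All (λ h → ¬ (t ∣ h)) (hooks λs)

AvoidsParts : List ℕ → List ℕ → Set
AvoidsParts C λs = All (λ p → p ∉ C) λs

Counted : List ℕ → ℕ → ℕ → List ℕ → Set
Counted C t n λs = IsPartition n λs × IsCore t λs × AvoidsParts C λs

totalHooks : ℕ → List (List ℕ) → ℕ
totalHooks k ps = sum (map (numHooks k) ps)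

{-# OPTIONS --safe #-}
-- Excluding parts 1 and 2 makes every row have length r ≥ 3. Box j of such a row has hook
-- (r − j − 1) + ℓⱼ + 1, ℓⱼ its leg, so only the last box can be a 1-hook, namely when the next
-- row is shorter, and the box in column r − 3 is a 3-hook when no lower row reaches that column.
-- In a 5-core with all parts ≥ 3 the next shorter row r′ cannot have r − 2 ≤ r′ < r: the hooks in
-- the first three columns of the two rows would cover five consecutive integers. Hence every row
-- containing a 1-hook also contains a 3-hook.
module Submission where

open import Defs
open import Data.Nat using (ℕ; _≤_)
open import Data.List using (List; _∷_; [])
open import Data.List.Relation.Unary.Unique.Propositional using (Unique)
open import Data.List.Membership.Propositional using (_∈_)
open import Function.Bundles using (_⇔_)

open import Data.Nat using (zero; suc; _+_; _∸_; _<_; _≥_; _≟_; _<?_; _≤?_; z≤n; s≤s; s≤s⁻¹; z<s; s<s; NonZero)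
open import Data.List.Membership.Propositional using (_∉_)
open import Data.Nat.Properties
open import Data.Nat.Divisibility using (_∣_; _∣0; ∣-refl; ∣m∣n⇒∣m+n)
open import Data.Nat.ListAction using (sum)
open import Data.List using (length; filter; map; upTo; applyUpTo; _++_)
open import Data.List.Properties using (filter-++; length-++; filter-all; filter-none; filter-accept; map-cong-local; map-upTo)
open import Data.List.Relation.Unary.All as All using (All; []; _∷_)
import Data.List.Relation.Unary.All.Properties as All
open import Data.List.Relation.Unary.Any using (here; there)
open import Data.List.Relation.Unary.Linked as Linked using (Linked)
open import Data.List.Relation.Unary.Linked.Properties using (Linked⇒All)
open import Data.Product using (_,_; _×_; ∃-syntax)
open import Data.Sum using (_⊎_; inj₁; inj₂)
open import Data.Empty using (⊥; ⊥-elim)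
open import Function using (id; flip; _∘′_)
open import Function.Bundles using (module Equivalence)
open import Relation.Nullary using (¬_; yes; no; contradiction)
open import Relation.Binary.PropositionalEquality

count : ℕ → List ℕ → ℕ
count k xs = length (filter (_≟ k) xs)

count-++ : ∀ k xs ys → count k (xs ++ ys) ≡ count k xs + count k ys
count-++ k xs ys = trans (cong length (filter-++ (_≟ k) xs ys)) (length-++ (filter (_≟ k) xs))

count-none : ∀ {k xs} → All (_≢ k) xs → count k xs ≡ 0
count-none none = cong length (filter-none (_≟ _) none)

count-++-≤ : ∀ {k l} xs ys → count k xs ≤ count l xs → count k ys ≤ count l ys →
             count k (xs ++ ys) ≤ count l (xs ++ ys)
count-++-≤ {k} {l} xs ys xs≤ ys≤ = begin
  count k (xs ++ ys)       ≡⟨ count-++ k xs ys ⟩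
  count k xs + count k ys  ≤⟨ +-mono-≤ xs≤ ys≤ ⟩
  count l xs + count l ys  ≡⟨ count-++ l xs ys ⟨
  count l (xs ++ ys)       ∎
  where open ≤-Reasoning

sum-map-mono : ∀ {A : Set} {f g : A → ℕ} xs → (∀ {x} → x ∈ xs → f x ≤ g x) →
               sum (map f xs) ≤ sum (map g xs)
sum-map-mono []       _  = z≤n
sum-map-mono (_ ∷ xs) f≤g = +-mono-≤ (f≤g (here refl)) (sum-map-mono xs (f≤g ∘′ there))

applyUpTo-last₃ : ∀ {A : Set} (f : ℕ → A) n →
                  applyUpTo f (3 + n) ≡ applyUpTo f n ++ f n ∷ f (1 + n) ∷ f (2 + n) ∷ []
applyUpTo-last₃ f zero    = refl
applyUpTo-last₃ f (suc n) = cong (f 0 ∷_) (applyUpTo-last₃ (λ x → f (suc x)) n)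

m<n≤2+m⇒n≡1+m∨n≡2+m : ∀ {m n} → m < n → n ≤ 2 + m → n ≡ 1 + m ⊎ n ≡ 2 + m
m<n≤2+m⇒n≡1+m∨n≡2+m m<n n≤2+m with m≤n⇒m<n∨m≡n n≤2+m
... | inj₁ n<2+m = inj₁ (≤-antisym (s≤s⁻¹ n<2+m) m<n)
... | inj₂ n≡2+m = inj₂ n≡2+m

multiple-among-consecutive : ∀ t .{{_ : NonZero t}} s → ∃[ k ] k < t × t ∣ k + s
multiple-among-consecutive (suc t) zero = 0 , z<s , (suc t ∣0)
multiple-among-consecutive (suc t) (suc s) with multiple-among-consecutive (suc t) s
... | zero  , _   , t∣s   = t , ≤-refl , subst (suc t ∣_) (sym (+-suc t s)) (∣m∣n⇒∣m+n ∣-refl t∣s)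
... | suc k , k<t , t∣k+s = k , <⇒≤ k<t , subst (suc t ∣_) (sym (+-suc k s)) t∣k+s

colLen-∷ : ∀ {r rs j} → j < r → colLen (r ∷ rs) j ≡ suc (colLen rs j)
colLen-∷ {r} {rs} {j} j<r = cong length (filter-accept (j <?_) {r} {rs} j<r)

colLen-all : ∀ {rs j} → All (j <_) rs → colLen rs j ≡ length rs
colLen-all {j = j} long = cong length (filter-all (j <?_) long)

colLen-none : ∀ {rs j} → All (_≤ j) rs → colLen rs j ≡ 0
colLen-none {j = j} short = cong length (filter-none (j <?_) (All.map ≤⇒≯ short))

colLen>0⇒< : ∀ {r rs j} → All (_≤ r) rs → 0 < colLen rs j → j < r
colLen>0⇒< {r} {j = j} bounded pos with j <? r
... | yes j<r = j<r
... | no  j≮r = contradiction (colLen-none (All.map (λ x≤r → ≤-trans x≤r (≮⇒≥ j≮r)) bounded))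
                             (>⇒≢ pos)

Linked-≥⇒All-≤ : ∀ {r rs} → Linked _≥_ (r ∷ rs) → All (_≤ r) rs
Linked-≥⇒All-≤ Linked.[-]          = []
Linked-≥⇒All-≤ (r≥x Linked.∷ sorted) = Linked⇒All (flip ≤-trans) r≥x sorted

hookAt : ℕ → List ℕ → ℕ → ℕ
hookAt r below j = ((r ∸ j) ∸ 1) + colLen below j + 1

rowHooks : ℕ → List ℕ → List ℕ
rowHooks r below = applyUpTo (hookAt r below) r

hooks′ : List ℕ → List ℕ
hooks′ []       = []
hooks′ (r ∷ rs) = rowHooks r rs ++ hooks′ rs

hooksFrom≡hooks′ : ∀ λs i rs → Linked _≥_ rs →
                   (∀ {j} → 0 < colLen rs j → colLen λs j ≡ i + colLen rs j) →
                   hooksFrom λs i rs ≡ hooks′ rs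
hooksFrom≡hooks′ λs i []       _      _     = refl
hooksFrom≡hooks′ λs i (r ∷ rs) sorted above =
  cong₂ _++_ row (hooksFrom≡hooks′ λs (suc i) rs (Linked.tail sorted) above′)
  where
  inRow : ∀ {j} → j < r → colLen λs j ≡ i + suc (colLen rs j)
  inRow j<r = trans (above (subst (0 <_) (sym (colLen-∷ j<r)) z<s)) (cong (i +_) (colLen-∷ j<r))
  leg : ∀ {j} → j < r → (colLen λs j ∸ i) ∸ 1 ≡ colLen rs j
  leg {j} j<r = cong (_∸ 1) (trans (cong (_∸ i) (inRow j<r)) (m+n∸m≡n i (suc (colLen rs j))))
  row : map (λ j → ((r ∸ j) ∸ 1) + ((colLen λs j ∸ i) ∸ 1) + 1) (upTo r) ≡ rowHooks r rs
  row = trans (map-cong-local (All.applyUpTo⁺₁ id r (λ {j} j<r → cong (λ l → ((r ∸ j) ∸ 1) + l + 1) (leg j<r))))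
              (map-upTo (hookAt r rs) r)
  above′ : ∀ {j} → 0 < colLen rs j → colLen λs j ≡ suc i + colLen rs j
  above′ pos = trans (inRow (colLen>0⇒< (Linked-≥⇒All-≤ sorted) pos)) (+-suc i _)

hooks≡hooks′ : ∀ {λs} → Linked _≥_ λs → hooks λs ≡ hooks′ λs
hooks≡hooks′ {λs} sorted = hooksFrom≡hooks′ λs 0 λs sorted (λ _ → refl)

hookAt-arm : ∀ a j below → hookAt (suc a + j) below j ≡ suc (a + colLen below j)
hookAt-arm a j below = begin
  ((suc a + j ∸ j) ∸ 1) + colLen below j + 1  ≡⟨ cong (λ x → (x ∸ 1) + colLen below j + 1) (m+n∸n≡m (suc a) j) ⟩
  a + colLen below j + 1                      ≡⟨ +-comm _ 1 ⟩
  suc (a + colLen below j)                    ∎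
  where open ≡-Reasoning

hookAt>1 : ∀ {r j} below → 2 + j ≤ r → 1 < hookAt r below j
hookAt>1 {r} {j} below 2+j≤r = +-monoˡ-≤ 1 (≤-trans arm≥1 (m≤m+n _ (colLen below j)))
  where
  arm≥1 : 1 ≤ (r ∸ j) ∸ 1
  arm≥1 = m+n≤o⇒m≤o∸n 1 (m+n≤o⇒m≤o∸n 2 2+j≤r)

rowHooks-split : ∀ q below → rowHooks (3 + q) below ≡
  applyUpTo (hookAt (3 + q) below) q ++
  (3 + colLen below q) ∷ (2 + colLen below (1 + q)) ∷ (1 + colLen below (2 + q)) ∷ []
rowHooks-split q below = trans (applyUpTo-last₃ (hookAt (3 + q) below) q)
  (cong (applyUpTo (hookAt (3 + q) below) q ++_)
        (cong₂ _∷_ (hookAt-arm 2 q below) (cong₂ _∷_ (hookAt-arm 1 (1 + q) below)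
                                                     (cong (_∷ []) (hookAt-arm 0 (2 + q) below)))))

count1≤count3-lastThree : ∀ a b c → (c ≡ 0 → a ≡ 0) →
  count 1 (3 + a ∷ 2 + b ∷ 1 + c ∷ []) ≤ count 3 (3 + a ∷ 2 + b ∷ 1 + c ∷ [])
count1≤count3-lastThree a b (suc c) _ = z≤n
count1≤count3-lastThree a b zero c≡0⇒a≡0 with c≡0⇒a≡0 refl
... | refl = s≤s z≤n

count1≤count3-rowHooks : ∀ q below → (colLen below (2 + q) ≡ 0 → colLen below q ≡ 0) →
                 count 1 (rowHooks (3 + q) below) ≤ count 3 (rowHooks (3 + q) below)
count1≤count3-rowHooks q below lastEmpty⇒thirdLastEmpty =
  subst (λ hs → count 1 hs ≤ count 3 hs) (sym (rowHooks-split q below))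
        (count-++-≤ prefix _ noOnes (count1≤count3-lastThree _ _ _ lastEmpty⇒thirdLastEmpty))
  where
  prefix : List ℕ
  prefix = applyUpTo (hookAt (3 + q) below) q
  noOnes : count 1 prefix ≤ count 3 prefix
  noOnes = subst (_≤ count 3 prefix) (sym (count-none (All.applyUpTo⁺₁ _ q λ j<q →
             >⇒≢ (hookAt>1 below (≤-trans (s≤s j<q) (m≤n+m _ 2))))))
                 z≤n

core-firstColumns : ∀ {P : ℕ → Set} {r rs j} → All P (hooks′ (r ∷ rs)) → j < 3 → 3 ≤ r → All (3 ≤_) rs →
                    P (((r ∸ j) ∸ 1) + length rs + 1)
core-firstColumns {P} {r} {rs} {j} all j<3 3≤r long =
  subst P (cong (λ l → ((r ∸ j) ∸ 1) + l + 1) (colLen-all (All.map (<-≤-trans j<3) long)))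
        (All.applyUpTo⁻ (hookAt r rs) r (All.++⁻ˡ (rowHooks r rs) all) (<-≤-trans j<3 3≤r))

-- With L rows below r′, the first three hooks of row r′ are r′ + L − 2, r′ + L − 1, r′ + L and
-- those of row r are r + L − 1, r + L, r + L + 1.
five-window : ∀ {r′ r L} → 3 ≤ r′ → r′ < r → r ≤ 2 + r′ →
              (∀ {j} → j < 3 → ¬ 5 ∣ ((r′ ∸ j) ∸ 1) + L + 1) →
              (∀ {j} → j < 3 → ¬ 5 ∣ suc (((r ∸ j) ∸ 1) + L + 1)) → ⊥
five-window {suc (suc (suc q′))} {_} {L} (s≤s (s≤s (s≤s _))) r′<r r≤2+r′ lower upper
  with multiple-among-consecutive 5 (q′ + L + 1) | m<n≤2+m⇒n≡1+m∨n≡2+m r′<r r≤2+r′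
... | 0 , _ , 5∣ | _         = lower (s<s (s<s z<s)) 5∣
... | 1 , _ , 5∣ | _         = lower (s<s z<s) 5∣
... | 2 , _ , 5∣ | _         = lower z<s 5∣
... | 3 , _ , 5∣ | inj₁ refl = upper (s<s z<s) 5∣
... | 3 , _ , 5∣ | inj₂ refl = upper (s<s (s<s z<s)) 5∣
... | 4 , _ , 5∣ | inj₁ refl = upper z<s 5∣
... | 4 , _ , 5∣ | inj₂ refl = upper (s<s z<s) 5∣
... | suc (suc (suc (suc (suc _)))) , s<s (s<s (s<s (s<s (s<s ())))) , _ | _

close-parts⇒¬core : ∀ {r r′ rs} → r′ < r → r ≤ 2 + r′ → All (3 ≤_) (r′ ∷ rs) →
                       ¬ All (λ h → ¬ 5 ∣ h) (hooks′ (r ∷ r′ ∷ rs))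
close-parts⇒¬core {r} {r′} {rs} r′<r r≤2+r′ long@(3≤r′ ∷ long′) core =
  five-window 3≤r′ r′<r r≤2+r′ lower upper
  where
  lower : ∀ {j} → j < 3 → ¬ 5 ∣ ((r′ ∸ j) ∸ 1) + length rs + 1
  lower j<3 = core-firstColumns (All.++⁻ʳ (rowHooks r (r′ ∷ rs)) core) j<3 3≤r′ long′
  upper : ∀ {j} → j < 3 → ¬ 5 ∣ suc (((r ∸ j) ∸ 1) + length rs + 1)
  upper j<3 = subst (λ h → ¬ 5 ∣ h) (cong (_+ 1) (+-suc _ (length rs)))
                    (core-firstColumns core j<3 (≤-trans 3≤r′ (<⇒≤ r′<r)) long)

core⇒colLen-gap : ∀ {q rs} → Linked _≥_ (3 + q ∷ rs) → All (3 ≤_) rs → All (λ h → ¬ 5 ∣ h) (hooks′ (3 + q ∷ rs)) →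
             colLen rs (2 + q) ≡ 0 → colLen rs q ≡ 0
core⇒colLen-gap {rs = []} _ _ _ _ = refl
core⇒colLen-gap {q} {r′ ∷ rs} sorted long core lastEmpty with r′ ≤? q | r′ ≤? 2 + q
... | yes r′≤q | _          = colLen-none (Linked⇒All (flip ≤-trans) r′≤q (Linked.tail sorted))
... | no r′≰q  | yes r′≤2+q = ⊥-elim (close-parts⇒¬core (s≤s r′≤2+q) (+-monoʳ-≤ 2 (≰⇒> r′≰q)) long core)
... | no _     | no r′≰2+q  = contradiction (trans (sym (colLen-∷ (≰⇒> r′≰2+q))) lastEmpty) λ ()

count1≤count3-hooks′ : ∀ {rs} → Linked _≥_ rs → All (3 ≤_) rs → All (λ h → ¬ 5 ∣ h) (hooks′ rs) →
                count 1 (hooks′ rs) ≤ count 3 (hooks′ rs)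
count1≤count3-hooks′ {[]} _ _ _ = z≤n
count1≤count3-hooks′ {suc (suc (suc q)) ∷ rs} sorted (s≤s (s≤s (s≤s _)) ∷ long) core =
  count-++-≤ (rowHooks (3 + q) rs) (hooks′ rs)
    (count1≤count3-rowHooks q rs (core⇒colLen-gap sorted long core))
    (count1≤count3-hooks′ (Linked.tail sorted) long (All.++⁻ʳ (rowHooks (3 + q) rs) core))

parts≥3 : ∀ {λs} → All (0 <_) λs → AvoidsParts (1 ∷ 2 ∷ []) λs → All (3 ≤_) λs
parts≥3 positive avoids = All.zipWith part≥3 (positive , avoids)
  where
  part≥3 : ∀ {p} → 0 < p × p ∉ (1 ∷ 2 ∷ []) → 3 ≤ p
  part≥3 {1}                 (_ , ∉) = ⊥-elim (∉ (here refl))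
  part≥3 {2}                 (_ , ∉) = ⊥-elim (∉ (there (here refl)))
  part≥3 {suc (suc (suc _))} _       = s≤s (s≤s (s≤s z≤n))

numHooks1≤numHooks3 : ∀ {n λs} → Counted (1 ∷ 2 ∷ []) 5 n λs → numHooks 1 λs ≤ numHooks 3 λs
numHooks1≤numHooks3 ((sorted , positive , _) , core , avoids) =
  subst (λ hs → count 1 hs ≤ count 3 hs) (sym (hooks≡hooks′ sorted))
        (count1≤count3-hooks′ sorted (parts≥3 positive avoids) (subst (All _) (hooks≡hooks′ sorted) core))

theorem1p8 : (n : ℕ) (ps : List (List ℕ)) → Unique ps
           → (∀ λs → (λs ∈ ps) ⇔ Counted (1 ∷ 2 ∷ []) 5 n λs)
           → totalHooks 1 ps ≤ totalHooks 3 ps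
theorem1p8 n ps _ counted =
  sum-map-mono ps (λ {λs} λs∈ps → numHooks1≤numHooks3 (Equivalence.to (counted λs) λs∈ps))
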